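{- Let $A \in \{\mathbb{Z},\mathbb{D}\}$, let $G_0$ be a position with $G_0 \in \{A \mid A\}$, and let $G_1$ be a position with $G_1 \in \{A\mid A\}\setminus A$. Then for every $x \in A$: (i) if $\mathrm{RS}_A(G_1) \le \mathrm{RS}_A(G_0)$ and $G_0 \ngeq x$, then $G_1 \ngeq x$; (ii) if $\mathrm{LS}_A(G_1) \ge \mathrm{LS}_A(G_0)$ and $G_0 \nleq x$, then $G_1 \nleq x$.
   Context: Positions are short (finite, loop-free) combinatorial games $G=\{G^{\mathcal L}\mid G^{\mathcal R}\}$, where $G^{\mathcal L}$, $G^{\mathcal R}$ are the finite sets of Left and Right options; $G^L$, $G^R$ denote individual Left/Right options. The relations $=,\le,<$ are the usual equality and partial order of games; $G\ngeq H$ means "$G<H$ or $G$ is incomparable (fuzzy) with $H$", and $G\nleq H$ means "$G>H$ or $G$ is fuzzy with $H$". $\mathbb{Z}$ denotes the integers and $\mathbb{D}$ the dyadic rationals, viewed as games (numbers) in the usual way. For $A\in\{\mathbb{Z},\mathbb{D}\}$, "$G\in A$" means $G$ is equal (as a game) to some element of $A$, and $\{A\mid A\}$ denotes the set of positions equal to $\{a\mid b\}$ for some $a,b\in A$ (note $A\subset\{A\mid A\}$). The $A$-stops are defined recursively: $\mathrm{LS}_A(G)=\mathrm{RS}_A(G)=$ the element of $A$ equal to $G$ if $G\in A$; otherwise $\mathrm{LS}_A(G)=\max\{\mathrm{RS}_A(G^L): G^L\in G^{\mathcal L}\}$ and $\mathrm{RS}_A(G)=\min\{\mathrm{LS}_A(G^R):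 G^R\in G^{\mathcal R}\}$. -}

module Defs where

open import Data.Nat using (ℕ; zero; suc)
open import Data.Integer using (ℤ; +_; -[1+_]; _+_; _/ℕ_; _%ℕ_)
open import Data.List using (List; []; _∷_)
open import Data.List.Membership.Propositional using (_∈_)
open import Data.Product using (Σ; _×_; _,_)
open import Data.Sum using (_⊎_)
open import Data.Empty using (⊥)
import Data.Unit
open import Relation.Nullary using (¬_)

data Game : Set where
  ⟨_∣_⟩ : List Game → List Game → Game

left : Game → List Game
left ⟨ L ∣ _ ⟩ = L

right : Game → List Game
right ⟨ _ ∣ R ⟩ = R

-- G ≤ H  iff  no G^L ≥ H and no H^R ≤ G.
-- Written positively with the auxiliary relation  G ⧏ H  ("not H ≤ G"):
--   G ≤ H  iff  every G^L ⧏ H  and  G ⧏ every H^R;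
--   G ⧏ H  iff  G ≤ some H^L  or  some G^R ≤ H.
-- (Inductive, hence the unique solution of the usual recursion on short games.)

infix 4 _≤_ _⧏_ _≈_

data _≤_ : Game → Game → Set
data _⧏_ : Game → Game → Set

data _≤_ where
  le : ∀ {G H} →
       (∀ {GL} → GL ∈ left G → GL ⧏ H) →
       (∀ {HR} → HR ∈ right H → G ⧏ HR) →
       G ≤ H

data _⧏_ where
  lf-l : ∀ {G H HL} → HL ∈ left H → G ≤ HL → G ⧏ H
  lf-r : ∀ {G H GR} → GR ∈ right G → GR ≤ H → G ⧏ H

_≈_ : Game → Game → Set
G ≈ H = (G ≤ H) × (H ≤ G)

intG : ℤ → Game
intG (+ zero)        = ⟨ [] ∣ [] ⟩
intG (+ suc n)       = ⟨ intG (+ n) ∷ [] ∣ [] ⟩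
intG -[1+ zero ]     = ⟨ [] ∣ intG (+ zero) ∷ [] ⟩
intG -[1+ suc n ]    = ⟨ [] ∣ intG -[1+ n ] ∷ [] ⟩

-- Dyadic rational m / 2^k as a game (canonical form):
--   k = 0            : the integer m;
--   k+1, m even      : m/2 over 2^k;
--   k+1, m = 2q+1    : { q/2^k | (q+1)/2^k }.
-- (_/ℕ_ and _%ℕ_ are floor division / nonnegative remainder.)
dyG : ℤ → ℕ → Game
dyG m zero = intG m
dyG m (suc k) with m %ℕ 2
... | zero  = dyG (m /ℕ 2) k
... | suc _ = ⟨ dyG (m /ℕ 2) k ∷ [] ∣ dyG ((m /ℕ 2) + + 1) k ∷ [] ⟩

data NumSet : Set where
  ZZ DD : NumSet

-- Elements of A: integers, resp. pairs (m , k) standing for m / 2^k.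
El : NumSet → Set
El ZZ = ℤ
El DD = ℤ × ℕ

emb : (A : NumSet) → El A → Game
emb ZZ m       = intG m
emb DD (m , k) = dyG m k

InA : NumSet → Game → Set
InA A G = Σ (El A) λ a → G ≈ emb A a

InBr : NumSet → Game → Set
InBr A G = Σ (El A) λ a → Σ (El A) λ b →
           G ≈ ⟨ emb A a ∷ [] ∣ emb A b ∷ [] ⟩

-- A-stops, as relations:  LS A G a  means  "LS_A(G) = a"  (a ∈ A, compared
-- via the game order on emb A a).  Defined by structural recursion on G:
--   if G ∈ A then LS_A(G) = RS_A(G) = the element of A equal to G;
--   otherwise LS_A(G) = max over G^L of RS_A(G^L),
--             RS_A(G) = min over G^R of LS_A(G^R).

mutual
  LS : (A : NumSet) → Game → El A → Set
  LS A ⟨ L ∣ R ⟩ a =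
    (⟨ L ∣ R ⟩ ≈ emb A a) ⊎
    (¬ InA A ⟨ L ∣ R ⟩ × anyRS A L a × allRS≤ A L a)

  RS : (A : NumSet) → Game → El A → Set
  RS A ⟨ L ∣ R ⟩ a =
    (⟨ L ∣ R ⟩ ≈ emb A a) ⊎
    (¬ InA A ⟨ L ∣ R ⟩ × anyLS A R a × allLS≥ A R a)

  anyRS : (A : NumSet) → List Game → El A → Set
  anyRS A []      a = ⊥
  anyRS A (g ∷ L) a = RS A g a ⊎ anyRS A L a

  allRS≤ : (A : NumSet) → List Game → El A → Set
  allRS≤ A []      a = Data.Unit.⊤
  allRS≤ A (g ∷ L) a = (∀ b → RS A g b → emb A b ≤ emb A a) × allRS≤ A L a

  anyLS : (A : NumSet) → List Game → El A → Set
  anyLS A []      a = ⊥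
  anyLS A (g ∷ R) a = LS A g a ⊎ anyLS A R a

  allLS≥ : (A : NumSet) → List Game → El A → Set
  allLS≥ A []      a = Data.Unit.⊤
  allLS≥ A (g ∷ R) a = (∀ b → LS A g b → emb A a ≤ emb A b) × allLS≥ A R a

{-# OPTIONS --safe #-}
-- Let x ∈ A.  For every position G, G ≱ x forces RS(G) ≤ x and G ≰ x forces
-- LS(G) ≥ x (induction on G; between numbers ⧏ already implies ≤).  So (i)
-- reduces to: x ≤ G₁ forces x < RS(G₁).  Induct over the positions K with
-- G₁ ≤ K (for Right stops) or G₁ ⧏ K (for Left stops).  A stop s ≤ x at K ∈ A
-- would give G₁ ≤ s ≤ x ≤ G₁, i.e. G₁ ∈ A.  Otherwise G₁ = {a | b} ⧏ K holds
-- either through a Left option K^L ≥ G₁, where we recurse, or because b ≤ K,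
-- and then LS(K) ≥ b > x.  Part (ii) is dual.
module Submission where

open import Data.Empty using (⊥-elim)
open import Data.Integer using (ℤ; +_; -[1+_]; _+_; _/ℕ_; _%ℕ_; -_; 1ℤ)
open import Data.Integer.Properties using (1-[1+n]≡-n)
open import Data.List using ([]; _∷_)
open import Data.List.Membership.Propositional using (_∈_)
open import Data.List.Relation.Unary.All as All using (All; []; _∷_)
open import Data.List.Relation.Unary.Any using (here; there)
open import Data.Nat as ℕ using (ℕ; zero; suc; s≤s; z≤n)
import Data.Nat.DivMod as ℕ
import Data.Nat.Properties as ℕ
open import Data.Product using (_×_; _,_; proj₁; proj₂; ∃; ∃-syntax)
open import Data.Sum using (_⊎_; inj₁; inj₂; [_,_]′; swap)
open import Data.Unit using (tt)
open import Effect.Monad using (RawMonad)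
open import Function using (case_of_)
open import Induction.WellFounded using (WellFounded; Acc; acc)
open import Level using (0ℓ)
open import Relation.Binary.PropositionalEquality
  using (_≡_; refl; sym; trans; cong; subst₂; module ≡-Reasoning)
open import Relation.Nullary using (¬_; Dec; yes; no)
open import Relation.Nullary.Decidable using (decidable-stable; ¬¬-excluded-middle)
open import Relation.Nullary.Negation using (Stable; contradiction; ¬¬-Monad; ¬¬-map)

open import Defs

_⊏_ : Game → Game → Set
G′ ⊏ G = G′ ∈ left G ⊎ G′ ∈ right G

mutual
  ⊏-wellFounded : WellFounded _⊏_
  ⊏-wellFounded ⟨ L ∣ R ⟩ = acc λ { (inj₁ p) → ∈-acc L p ; (inj₂ p) → ∈-acc R p }

  ∈-acc : ∀ {G} Gs → G ∈ Gs → Acc _⊏_ G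
  ∈-acc (G ∷ _)  (here refl) = ⊏-wellFounded G
  ∈-acc (_ ∷ Gs) (there p)   = ∈-acc Gs p

≤-refl : ∀ {G} → G ≤ G
≤-refl {G} = go (⊏-wellFounded G)
  where
  go : ∀ {G} → Acc _⊏_ G → G ≤ G
  go (acc rs) = le (λ p → lf-l p (go (rs (inj₁ p)))) (λ p → lf-r p (go (rs (inj₂ p))))

mutual
  ≤-trans : ∀ {G H K} → G ≤ H → H ≤ K → G ≤ K
  ≤-trans G≤H@(le GL⧏H _) H≤K@(le _ H⧏KR) =
    le (λ p → ⧏-≤-trans (GL⧏H p) H≤K) (λ p → ≤-⧏-trans G≤H (H⧏KR p))

  ⧏-≤-trans : ∀ {G H K} → G ⧏ H → H ≤ K → G ⧏ K
  ⧏-≤-trans (lf-l p G≤HL) (le HL⧏K _) = ≤-⧏-trans G≤HL (HL⧏K p)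
  ⧏-≤-trans (lf-r p GR≤H) H≤K         = lf-r p (≤-trans GR≤H H≤K)

  ≤-⧏-trans : ∀ {G H K} → G ≤ H → H ⧏ K → G ⧏ K
  ≤-⧏-trans G≤H           (lf-l p H≤KL) = lf-l p (≤-trans G≤H H≤KL)
  ≤-⧏-trans (le _ G⧏HR) (lf-r p HR≤K) = ⧏-≤-trans (G⧏HR p) HR≤K

≤⇒¬⧏ : ∀ {G H} → G ≤ H → ¬ H ⧏ G
≤⇒¬⧏ (le GL⧏H _) (lf-l p H≤GL) = ≤⇒¬⧏ H≤GL (GL⧏H p)
≤⇒¬⧏ (le _ G⧏HR) (lf-r p HR≤G) = ≤⇒¬⧏ HR≤G (G⧏HR p)

⧏-irrefl : ∀ {G} → ¬ G ⧏ G
⧏-irrefl = ≤⇒¬⧏ ≤-refl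

all-or-any : ∀ {a p q} {X : Set a} {P : X → Set p} {Q : X → Set q} xs →
             (∀ {x} → x ∈ xs → P x ⊎ Q x) → (∀ {x} → x ∈ xs → P x) ⊎ (∃[ x ] x ∈ xs × Q x)
all-or-any []       P⊎Q = inj₁ λ ()
all-or-any (x ∷ xs) P⊎Q with P⊎Q (here refl) | all-or-any xs (λ p → P⊎Q (there p))
... | inj₂ Qx | _                  = inj₂ (x , here refl , Qx)
... | inj₁ _  | inj₂ (y , p , Qy)  = inj₂ (y , there p , Qy)
... | inj₁ Px | inj₁ Pxs           = inj₁ λ { (here refl) → Px ; (there p) → Pxs p }

≤⊎⧏ : ∀ G H → G ≤ H ⊎ H ⧏ G
≤⊎⧏ G H = go (⊏-wellFounded G) (⊏-wellFounded H)
  where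
  go : ∀ {G H} → Acc _⊏_ G → Acc _⊏_ H → G ≤ H ⊎ H ⧏ G
  go {G} {H} (acc rsG) (acc rsH)
    with all-or-any (left G) (λ p → swap (go (acc rsH) (rsG (inj₁ p))))
       | all-or-any (right H) (λ p → swap (go (rsH (inj₂ p)) (acc rsG)))
  ... | inj₂ (_ , p , H≤GL) | _                    = inj₂ (lf-l p H≤GL)
  ... | inj₁ _              | inj₂ (_ , p , HR≤G)  = inj₂ (lf-r p HR≤G)
  ... | inj₁ GL⧏H           | inj₁ G⧏HR            = inj₁ (le GL⧏H G⧏HR)

≰⇒⧏ : ∀ {G H} → ¬ G ≤ H → H ⧏ G
≰⇒⧏ {G} {H} G≰H with ≤⊎⧏ G H
... | inj₁ G≤H = contradiction G≤H G≰H
... | inj₂ H⧏G = H⧏G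

_≤?_ : ∀ G H → Dec (G ≤ H)
G ≤? H = [ yes , (λ H⧏G → no (λ G≤H → ≤⇒¬⧏ G≤H H⧏G)) ]′ (≤⊎⧏ G H)

_⧏?_ : ∀ G H → Dec (G ⧏ H)
G ⧏? H = [ (λ H≤G → no (≤⇒¬⧏ H≤G)) , yes ]′ (≤⊎⧏ H G)

≤-stable : ∀ {G H} → Stable (G ≤ H)
≤-stable {G} {H} = decidable-stable (G ≤? H)

⧏-stable : ∀ {G H} → Stable (G ⧏ H)
⧏-stable {G} {H} = decidable-stable (G ⧏? H)

-- Weaker than being a number, but enough for ⧏ to imply ≤ between such games.
Numeric : Game → Set
Numeric G = (∀ {GL} → GL ∈ left G → GL ≤ G) × (∀ {GR} → GR ∈ right G → G ≤ GR)

numeric-⟨∣⟩ : ∀ {L R} → All Numeric L → All Numeric R →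
              (∀ {GL GR} → GL ∈ L → GR ∈ R → GL ⧏ GR) → Numeric ⟨ L ∣ R ⟩
numeric-⟨∣⟩ numL numR L⧏R =
  (λ p → le (λ q → lf-l p (proj₁ (All.lookup numL p) q)) (λ q → L⧏R p q)) ,
  (λ q → le (λ p → L⧏R p q) (λ r → lf-r q (proj₂ (All.lookup numR q) r)))

numeric-⧏⇒≤ : ∀ {G H} → Numeric G → Numeric H → G ⧏ H → G ≤ H
numeric-⧏⇒≤ _     numH (lf-l p G≤HL) = ≤-trans G≤HL (proj₁ numH p)
numeric-⧏⇒≤ numG _    (lf-r p GR≤H) = ≤-trans (proj₂ numG p) GR≤H

[2+n]%2≡n%2 : ∀ n → suc (suc n) ℕ.% 2 ≡ n ℕ.% 2
[2+n]%2≡n%2 n = trans (cong (ℕ._% 2) (ℕ.+-comm 2 n)) (ℕ.[m+n]%n≡m%n n 2)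

[2+n]/2≡1+[n/2] : ∀ n → suc (suc n) ℕ./ 2 ≡ suc (n ℕ./ 2)
[2+n]/2≡1+[n/2] n = ℕ.m/n≡1+[m∸n]/n {suc (suc n)} {2} (s≤s (s≤s z≤n))

ℕ-halve-suc : ∀ n → (n ℕ.% 2 ≡ 0 × suc n ℕ.% 2 ≡ 1 × suc n ℕ./ 2 ≡ n ℕ./ 2)
                  ⊎ (n ℕ.% 2 ≡ 1 × suc n ℕ.% 2 ≡ 0 × suc n ℕ./ 2 ≡ suc (n ℕ./ 2))
ℕ-halve-suc zero = inj₁ (refl , refl , refl)
ℕ-halve-suc (suc n) with ℕ-halve-suc n
... | inj₁ (n-even , 1+n-odd , 1+n/2≡n/2) =
  inj₂ (1+n-odd , trans ([2+n]%2≡n%2 n) n-even , trans ([2+n]/2≡1+[n/2] n) (cong suc (sym 1+n/2≡n/2)))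
... | inj₂ (n-odd , 1+n-even , 1+n/2≡1+[n/2]) =
  inj₁ (1+n-even , trans ([2+n]%2≡n%2 n) n-odd , trans ([2+n]/2≡1+[n/2] n) (sym 1+n/2≡1+[n/2]))

-[1+]-halve-even : ∀ n → suc n ℕ.% 2 ≡ 0 → -[1+ n ] %ℕ 2 ≡ 0 × -[1+ n ] /ℕ 2 ≡ - + (suc n ℕ./ 2)
-[1+]-halve-even n even rewrite even = refl , refl

-[1+]-halve-odd : ∀ n → suc n ℕ.% 2 ≡ 1 → -[1+ n ] %ℕ 2 ≡ 1 × -[1+ n ] /ℕ 2 ≡ -[1+ suc n ℕ./ 2 ]
-[1+]-halve-odd n odd rewrite odd = refl , refl

halve-suc : ∀ q → (q %ℕ 2 ≡ 0 × (q + 1ℤ) %ℕ 2 ≡ 1 × (q + 1ℤ) /ℕ 2 ≡ q /ℕ 2)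
                ⊎ (q %ℕ 2 ≡ 1 × (q + 1ℤ) %ℕ 2 ≡ 0 × (q + 1ℤ) /ℕ 2 ≡ q /ℕ 2 + 1ℤ)
halve-suc (+ n) rewrite ℕ.+-comm n 1 with ℕ-halve-suc n
... | inj₁ (n-even , 1+n-odd , eq) = inj₁ (n-even , 1+n-odd , cong +_ eq)
... | inj₂ (n-odd , 1+n-even , eq) = inj₂ (n-odd , 1+n-even , cong +_ (trans eq (ℕ.+-comm 1 _)))
halve-suc -[1+ zero ] = inj₂ (refl , refl , refl)
halve-suc -[1+ suc m ] with ℕ-halve-suc (suc m)
... | inj₁ (1+m-even , 2+m-odd , eq)
  with -[1+]-halve-odd (suc m) 2+m-odd | -[1+]-halve-even m 1+m-even
...  | q-odd , q/2≡ | q+1-even , [q+1]/2≡ =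
  inj₂ (q-odd , q+1-even , (begin
    -[1+ m ] /ℕ 2                      ≡⟨ [q+1]/2≡ ⟩
    - + (suc m ℕ./ 2)                  ≡⟨ 1-[1+n]≡-n _ ⟨
    -[1+ suc m ℕ./ 2 ] + 1ℤ            ≡⟨ cong (λ k → -[1+ k ] + 1ℤ) eq ⟨
    -[1+ suc (suc m) ℕ./ 2 ] + 1ℤ      ≡⟨ cong (_+ 1ℤ) q/2≡ ⟨
    -[1+ suc m ] /ℕ 2 + 1ℤ             ∎))
  where open ≡-Reasoning
halve-suc -[1+ suc m ] | inj₂ (1+m-odd , 2+m-even , eq)
  with -[1+]-halve-even (suc m) 2+m-even | -[1+]-halve-odd m 1+m-odd
...  | q-even , q/2≡ | q+1-odd , [q+1]/2≡ =
  inj₁ (q-even , q+1-odd , trans [q+1]/2≡ (trans (cong (λ k → - + k) (sym eq)) (sym q/2≡)))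

dyG-even : ∀ q k → q %ℕ 2 ≡ 0 → dyG q (suc k) ≡ dyG (q /ℕ 2) k
dyG-even q k even rewrite even = refl

dyG-odd : ∀ q k → q %ℕ 2 ≡ 1 → dyG q (suc k) ≡ ⟨ dyG (q /ℕ 2) k ∷ [] ∣ dyG (q /ℕ 2 + 1ℤ) k ∷ [] ⟩
dyG-odd q k odd rewrite odd = refl

intG-⧏-suc : ∀ q → intG q ⧏ intG (q + 1ℤ)
intG-⧏-suc (+ n) rewrite ℕ.+-comm n 1 = lf-l (here refl) ≤-refl
intG-⧏-suc -[1+ zero ]  = lf-r (here refl) ≤-refl
intG-⧏-suc -[1+ suc n ] = lf-r (here refl) ≤-refl

dyG-⧏-suc : ∀ q k → dyG q k ⧏ dyG (q + 1ℤ) k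
dyG-⧏-suc q zero = intG-⧏-suc q
dyG-⧏-suc q (suc k) with halve-suc q
... | inj₁ (q-even , q+1-odd , [q+1]/2≡q/2) =
  subst₂ _⧏_ (sym (dyG-even q k q-even)) (sym (dyG-odd (q + 1ℤ) k q+1-odd))
    (lf-l (here (cong (λ h → dyG h k) (sym [q+1]/2≡q/2))) ≤-refl)
... | inj₂ (q-odd , q+1-even , [q+1]/2≡q/2+1) =
  subst₂ _⧏_ (sym (dyG-odd q k q-odd)) (sym (dyG-even (q + 1ℤ) k q+1-even))
    (lf-r (here (cong (λ h → dyG h k) [q+1]/2≡q/2+1)) ≤-refl)

intG-numeric : ∀ z → Numeric (intG z)
intG-numeric (+ zero)     = (λ ()) , (λ ())
intG-numeric (+ suc n)    = numeric-⟨∣⟩ (intG-numeric (+ n) ∷ []) [] (λ _ ())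
intG-numeric -[1+ zero ]  = numeric-⟨∣⟩ [] (intG-numeric (+ zero) ∷ []) (λ ())
intG-numeric -[1+ suc n ] = numeric-⟨∣⟩ [] (intG-numeric -[1+ n ] ∷ []) (λ ())

dyG-numeric : ∀ m k → Numeric (dyG m k)
dyG-numeric m zero = intG-numeric m
dyG-numeric m (suc k) with m %ℕ 2
... | zero  = dyG-numeric (m /ℕ 2) k
... | suc _ = numeric-⟨∣⟩ (dyG-numeric (m /ℕ 2) k ∷ []) (dyG-numeric (m /ℕ 2 + 1ℤ) k ∷ [])
                          (λ { (here refl) (here refl) → dyG-⧏-suc (m /ℕ 2) k })

emb-numeric : ∀ A a → Numeric (emb A a)
emb-numeric ZZ z       = intG-numeric z
emb-numeric DD (m , k) = dyG-numeric m k

Elem : NumSet → Game → Set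
Elem A G = ∃[ a ] G ≡ emb A a

Elem-numeric : ∀ {A G} → Elem A G → Numeric G
Elem-numeric {A} (a , refl) = emb-numeric A a

intG-left : ∀ z {GL} → GL ∈ left (intG z) → Elem ZZ GL
intG-left (+ zero)     ()
intG-left (+ suc n)    (here refl) = + n , refl
intG-left -[1+ zero ]  ()
intG-left -[1+ suc _ ] ()

intG-right : ∀ z {GR} → GR ∈ right (intG z) → Elem ZZ GR
intG-right (+ zero)     ()
intG-right (+ suc _)    ()
intG-right -[1+ zero ]  (here refl) = + 0 , refl
intG-right -[1+ suc n ] (here refl) = -[1+ n ] , refl

dyG-left : ∀ m k {GL} → GL ∈ left (dyG m k) → Elem DD GL
dyG-left m zero p with intG-left m p
... | z , refl = (z , 0) , refl
dyG-left m (suc k) p with m %ℕ 2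
dyG-left m (suc k) p           | zero  = dyG-left (m /ℕ 2) k p
dyG-left m (suc k) (here refl) | suc _ = (m /ℕ 2 , k) , refl

dyG-right : ∀ m k {GR} → GR ∈ right (dyG m k) → Elem DD GR
dyG-right m zero p with intG-right m p
... | z , refl = (z , 0) , refl
dyG-right m (suc k) p           with m %ℕ 2
dyG-right m (suc k) p           | zero  = dyG-right (m /ℕ 2) k p
dyG-right m (suc k) (here refl) | suc _ = (m /ℕ 2 + 1ℤ , k) , refl

Elem-left : ∀ {A G GL} → Elem A G → GL ∈ left G → Elem A GL
Elem-left {ZZ} (z , refl)       = intG-left z
Elem-left {DD} ((m , k) , refl) = dyG-left m k

Elem-right : ∀ {A G GR} → Elem A G → GR ∈ right G → Elem A GR
Elem-right {ZZ} (z , refl)       = intG-right z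
Elem-right {DD} ((m , k) , refl) = dyG-right m k

≈-Elem⇒InA : ∀ {A G H} → Elem A H → G ≈ H → InA A G
≈-Elem⇒InA (a , refl) G≈a = a , G≈a

≈-intG⇒InA : ∀ {A G z} → G ≈ intG z → InA A G
≈-intG⇒InA {ZZ} {z = z} G≈z = z , G≈z
≈-intG⇒InA {DD} {z = z} G≈z = (z , 0) , G≈z

Eventually : ∀ {p} → (ℕ → Set p) → Set p
Eventually P = ∃[ N ] ∀ M → N ℕ.≤ M → P M

eventually-all : ∀ {a p} {X : Set a} {P : X → ℕ → Set p} xs →
                 (∀ {x} → x ∈ xs → Eventually (P x)) → Eventually (λ M → ∀ {x} → x ∈ xs → P x M)
eventually-all []       ev = 0 , λ _ _ ()
eventually-all (x ∷ xs) ev with ev (here refl) | eventually-all xs (λ p → ev (there p))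
... | N₁ , Px | N₂ , Pxs = N₁ ℕ.⊔ N₂ , λ where
  M N≤M (here refl) → Px M (ℕ.≤-trans (ℕ.m≤m⊔n N₁ N₂) N≤M)
  M N≤M (there p)   → Pxs M (ℕ.≤-trans (ℕ.m≤n⊔m N₁ N₂) N≤M) p

eventually-≤-intG : ∀ G → Eventually (λ M → G ≤ intG (+ M))
eventually-≤-intG G = go (⊏-wellFounded G)
  where
  go : ∀ {G} → Acc _⊏_ G → Eventually (λ M → G ≤ intG (+ M))
  go {⟨ L ∣ _ ⟩} (acc rs) with eventually-all L (λ p → go (rs (inj₁ p)))
  ... | N , L≤M = suc N , λ { (suc M) (s≤s N≤M) → le (λ p → lf-l (here refl) (L≤M M N≤M p)) (λ ()) }

eventually-intG-≤ : ∀ G → Eventually (λ M → intG -[1+ M ] ≤ G)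
eventually-intG-≤ G = go (⊏-wellFounded G)
  where
  go : ∀ {G} → Acc _⊏_ G → Eventually (λ M → intG -[1+ M ] ≤ G)
  go {⟨ _ ∣ R ⟩} (acc rs) with eventually-all R (λ p → go (rs (inj₂ p)))
  ... | N , M≤R = suc N , λ { (suc M) (s≤s N≤M) → le (λ ()) (λ p → lf-r (here refl) (M≤R M N≤M p)) }

no-right-options-integer : ∀ L → ∃[ z ] ⟨ L ∣ [] ⟩ ≈ intG z
no-right-options-integer L with eventually-≤-intG ⟨ L ∣ [] ⟩
... | N , G≤M with G≤M N ℕ.≤-refl
...   | le L⧏N _ = descend N L⧏N
  where
  -- {L |} is the least n ≥ 0 with L ⧏ n.
  descend : ∀ n → (∀ {GL} → GL ∈ L → GL ⧏ intG (+ n)) → ∃[ z ] ⟨ L ∣ [] ⟩ ≈ intG z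
  descend zero    L⧏0 = + 0 , le L⧏0 (λ ()) , le (λ ()) (λ ())
  descend (suc n) L⧏1+n with all-or-any L (λ {GL} _ → swap (≤⊎⧏ (intG (+ n)) GL))
  ... | inj₁ L⧏n            = descend n L⧏n
  ... | inj₂ (_ , p , n≤GL) = + suc n , le L⧏1+n (λ ()) , le (λ { (here refl) → lf-l p n≤GL }) (λ ())

no-left-options-integer : ∀ R → ∃[ z ] ⟨ [] ∣ R ⟩ ≈ intG z
no-left-options-integer R with eventually-intG-≤ ⟨ [] ∣ R ⟩
... | N , M≤G with M≤G N ℕ.≤-refl
...   | le _ -[1+N]⧏R = descend N -[1+N]⧏R
  where
  descend : ∀ n → (∀ {GR} → GR ∈ R → intG -[1+ n ] ⧏ GR) → ∃[ z ] ⟨ [] ∣ R ⟩ ≈ intG z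
  descend zero -1⧏R with all-or-any R (λ {GR} _ → swap (≤⊎⧏ GR (intG (+ 0))))
  ... | inj₁ 0⧏R            = + 0 , le (λ ()) (λ ()) , le (λ ()) 0⧏R
  ... | inj₂ (_ , p , GR≤0) = -[1+ 0 ] , le (λ ()) (λ { (here refl) → lf-r p GR≤0 }) , le (λ ()) -1⧏R
  descend (suc n) -[2+n]⧏R with all-or-any R (λ {GR} _ → swap (≤⊎⧏ GR (intG -[1+ n ])))
  ... | inj₁ -[1+n]⧏R            = descend n -[1+n]⧏R
  ... | inj₂ (_ , p , GR≤-[1+n]) =
    -[1+ suc n ] , le (λ ()) (λ { (here refl) → lf-r p GR≤-[1+n] }) , le (λ ()) -[2+n]⧏R

module Stops (A : NumSet) where

  anyRS-∈ : ∀ {L a} → anyRS A L a → ∃[ GL ] GL ∈ L × RS A GL a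
  anyRS-∈ {_ ∷ _} (inj₁ rs)  = _ , here refl , rs
  anyRS-∈ {_ ∷ _} (inj₂ any) = let GL , p , rs = anyRS-∈ any in GL , there p , rs

  anyLS-∈ : ∀ {R a} → anyLS A R a → ∃[ GR ] GR ∈ R × LS A GR a
  anyLS-∈ {_ ∷ _} (inj₁ ls)  = _ , here refl , ls
  anyLS-∈ {_ ∷ _} (inj₂ any) = let GR , p , ls = anyLS-∈ any in GR , there p , ls

  allRS≤-∈ : ∀ {L a GL} → allRS≤ A L a → GL ∈ L → ∀ b → RS A GL b → emb A b ≤ emb A a
  allRS≤-∈ (b≤a , _)   (here refl) = b≤a
  allRS≤-∈ (_ , all≤a) (there p)   = allRS≤-∈ all≤a p

  allLS≥-∈ : ∀ {R a GR} → allLS≥ A R a → GR ∈ R → ∀ b → LS A GR b → emb A a ≤ emb A b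
  allLS≥-∈ (a≤b , _)   (here refl) = a≤b
  allLS≥-∈ (_ , all≥a) (there p)   = allLS≥-∈ all≥a p

  allRS≤-mono : ∀ {L a a′} → allRS≤ A L a → emb A a ≤ emb A a′ → allRS≤ A L a′
  allRS≤-mono {[]}    _             _     = tt
  allRS≤-mono {_ ∷ _} (b≤a , all≤a) a≤a′ = (λ b rs → ≤-trans (b≤a b rs) a≤a′) , allRS≤-mono all≤a a≤a′

  allLS≥-mono : ∀ {R a a′} → allLS≥ A R a → emb A a′ ≤ emb A a → allLS≥ A R a′
  allLS≥-mono {[]}    _             _     = tt
  allLS≥-mono {_ ∷ _} (a≤b , all≥a) a′≤a = (λ b ls → ≤-trans a′≤a (a≤b b ls)) , allLS≥-mono all≥a a′≤a

  LS-unique : ∀ {G a b} → LS A G a → LS A G b → emb A a ≤ emb A b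
  LS-unique {⟨ _ ∣ _ ⟩} (inj₁ G≈a) (inj₁ G≈b)            = ≤-trans (proj₂ G≈a) (proj₁ G≈b)
  LS-unique {⟨ _ ∣ _ ⟩} (inj₁ G≈a) (inj₂ (G∉A , _))      = ⊥-elim (G∉A (_ , G≈a))
  LS-unique {⟨ _ ∣ _ ⟩} (inj₂ (G∉A , _)) (inj₁ G≈b)      = ⊥-elim (G∉A (_ , G≈b))
  LS-unique {⟨ _ ∣ _ ⟩} (inj₂ (_ , any , _)) (inj₂ (_ , _ , all≤b)) =
    let _ , p , rs = anyRS-∈ any in allRS≤-∈ all≤b p _ rs

  RS-unique : ∀ {G a b} → RS A G a → RS A G b → emb A a ≤ emb A b
  RS-unique {⟨ _ ∣ _ ⟩} (inj₁ G≈a) (inj₁ G≈b)            = ≤-trans (proj₂ G≈a) (proj₁ G≈b)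
  RS-unique {⟨ _ ∣ _ ⟩} (inj₁ G≈a) (inj₂ (G∉A , _))      = ⊥-elim (G∉A (_ , G≈a))
  RS-unique {⟨ _ ∣ _ ⟩} (inj₂ (G∉A , _)) (inj₁ G≈b)      = ⊥-elim (G∉A (_ , G≈b))
  RS-unique {⟨ _ ∣ _ ⟩} (inj₂ (_ , _ , all≥a)) (inj₂ (_ , any , _)) =
    let _ , p , ls = anyLS-∈ any in allLS≥-∈ all≥a p _ ls

  emb-total : ∀ a b → emb A a ≤ emb A b ⊎ emb A b ≤ emb A a
  emb-total a b with ≤⊎⧏ (emb A a) (emb A b)
  ... | inj₁ a≤b = inj₁ a≤b
  ... | inj₂ b⧏a = inj₂ (numeric-⧏⇒≤ (emb-numeric A b) (emb-numeric A a) b⧏a)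

  open RawMonad (¬¬-Monad {0ℓ})

  RS-max-exists : ∀ G L → (∀ {GL} → GL ∈ G ∷ L → ¬ ¬ ∃ (RS A GL)) →
                  ¬ ¬ ∃ λ a → anyRS A (G ∷ L) a × allRS≤ A (G ∷ L) a
  RS-max-exists G [] ∃RS = do
    a , rs ← ∃RS (here refl)
    pure (a , inj₁ rs , (λ _ rs′ → RS-unique rs′ rs) , tt)
  RS-max-exists G (H ∷ L) ∃RS = do
    a′ , any , all≤a′ ← RS-max-exists H L (λ p → ∃RS (there p))
    a , rs ← ∃RS (here refl)
    pure (case emb-total a a′ of λ where
      (inj₁ a≤a′) → a′ , inj₂ any , (λ _ rs′ → ≤-trans (RS-unique rs′ rs) a≤a′) , all≤a′
      (inj₂ a′≤a) → a , inj₁ rs , (λ _ rs′ → RS-unique rs′ rs) , allRS≤-mono all≤a′ a′≤a)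

  LS-min-exists : ∀ G R → (∀ {GR} → GR ∈ G ∷ R → ¬ ¬ ∃ (LS A GR)) →
                  ¬ ¬ ∃ λ a → anyLS A (G ∷ R) a × allLS≥ A (G ∷ R) a
  LS-min-exists G [] ∃LS = do
    a , ls ← ∃LS (here refl)
    pure (a , inj₁ ls , (λ _ ls′ → LS-unique ls ls′) , tt)
  LS-min-exists G (H ∷ R) ∃LS = do
    a′ , any , all≥a′ ← LS-min-exists H R (λ p → ∃LS (there p))
    a , ls ← ∃LS (here refl)
    pure (case emb-total a a′ of λ where
      (inj₁ a≤a′) → a , inj₁ ls , (λ _ ls′ → LS-unique ls ls′) , allLS≥-mono all≥a′ a≤a′
      (inj₂ a′≤a) → a′ , inj₂ any , (λ _ ls′ → ≤-trans a′≤a (LS-unique ls ls′)) , all≥a′)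

  -- Membership G ∈ A is not decided here, so stops exist only up to double negation;
  -- that suffices wherever they are used, as ≤ and ⧏ are stable.
  private
    mutual
      LS-exists′ : ∀ {G} → Acc _⊏_ G → ¬ ¬ ∃ (LS A G)
      LS-exists′ {⟨ [] ∣ R ⟩} _ =
        let a , G≈a = ≈-intG⇒InA (proj₂ (no-left-options-integer R)) in pure (a , inj₁ G≈a)
      LS-exists′ {⟨ GL ∷ L ∣ R ⟩} (acc rs) = do
        no G∉A ← ¬¬-excluded-middle
          where yes (a , G≈a) → pure (a , inj₁ G≈a)
        a , any , all≤a ← RS-max-exists GL L (λ p → RS-exists′ (rs (inj₁ p)))
        pure (a , inj₂ (G∉A , any , all≤a))

      RS-exists′ : ∀ {G} → Acc _⊏_ G → ¬ ¬ ∃ (RS A G)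
      RS-exists′ {⟨ L ∣ [] ⟩} _ =
        let a , G≈a = ≈-intG⇒InA (proj₂ (no-right-options-integer L)) in pure (a , inj₁ G≈a)
      RS-exists′ {⟨ L ∣ GR ∷ R ⟩} (acc rs) = do
        no G∉A ← ¬¬-excluded-middle
          where yes (a , G≈a) → pure (a , inj₁ G≈a)
        a , any , all≥a ← LS-min-exists GR R (λ p → LS-exists′ (rs (inj₂ p)))
        pure (a , inj₂ (G∉A , any , all≥a))

  LS-exists : ∀ G → ¬ ¬ ∃ (LS A G)
  LS-exists G = LS-exists′ (⊏-wellFounded G)

  RS-exists : ∀ G → ¬ ¬ ∃ (RS A G)
  RS-exists G = RS-exists′ (⊏-wellFounded G)

  private
    mutual
      ≤⇒≤RS′ : ∀ {G y r} → Acc _⊏_ G → Acc _⊏_ y → Elem A y → y ≤ G → RS A G r → y ≤ emb A r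
      ≤⇒≤RS′ {⟨ _ ∣ _ ⟩} _ _ _ y≤G (inj₁ G≈r) = ≤-trans y≤G (proj₁ G≈r)
      ≤⇒≤RS′ {⟨ _ ∣ _ ⟩} (acc rsG) accy y∈A (le _ y⧏GR) (inj₂ (_ , any , _)) =
        let _ , p , ls = anyLS-∈ any in ⧏⇒≤LS′ (rsG (inj₂ p)) accy y∈A (y⧏GR p) ls

      ⧏⇒≤LS′ : ∀ {G y l} → Acc _⊏_ G → Acc _⊏_ y → Elem A y → y ⧏ G → LS A G l → y ≤ emb A l
      ⧏⇒≤LS′ {⟨ _ ∣ _ ⟩} {l = l} _ _ y∈A y⧏G (inj₁ G≈l) =
        numeric-⧏⇒≤ (Elem-numeric y∈A) (emb-numeric A l) (⧏-≤-trans y⧏G (proj₁ G≈l))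
      ⧏⇒≤LS′ {⟨ _ ∣ _ ⟩} (acc rsG) accy y∈A (lf-l p y≤GL) (inj₂ (_ , _ , all≤l)) =
        ≤-stable (¬¬-map (λ (s , rs) → ≤-trans (≤⇒≤RS′ (rsG (inj₁ p)) accy y∈A y≤GL rs)
                                                (allRS≤-∈ all≤l p s rs))
                         (RS-exists _))
      ⧏⇒≤LS′ {⟨ _ ∣ _ ⟩} accG (acc rsy) y∈A (lf-r p yR≤G) ls@(inj₂ _) =
        ≤-trans (proj₂ (Elem-numeric y∈A) p) (≤⇒≤LS′ accG (rsy (inj₂ p)) (Elem-right y∈A p) yR≤G ls)

      ≤⇒≤LS′ : ∀ {G y l} → Acc _⊏_ G → Acc _⊏_ y → Elem A y → y ≤ G → LS A G l → y ≤ emb A l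
      ≤⇒≤LS′ {⟨ _ ∣ _ ⟩} _ _ _ y≤G (inj₁ G≈l) = ≤-trans y≤G (proj₁ G≈l)
      ≤⇒≤LS′ {⟨ _ ∣ _ ⟩} accG accy y∈A y≤G ls@(inj₂ (G∉A , _)) =
        ⧏⇒≤LS′ accG accy y∈A (≰⇒⧏ λ G≤y → G∉A (≈-Elem⇒InA y∈A (G≤y , y≤G))) ls

    mutual
      ≤⇒LS≤′ : ∀ {G y l} → Acc _⊏_ G → Acc _⊏_ y → Elem A y → G ≤ y → LS A G l → emb A l ≤ y
      ≤⇒LS≤′ {⟨ _ ∣ _ ⟩} _ _ _ G≤y (inj₁ G≈l) = ≤-trans (proj₂ G≈l) G≤y
      ≤⇒LS≤′ {⟨ _ ∣ _ ⟩} (acc rsG) accy y∈A (le GL⧏y _) (inj₂ (_ , any , _)) =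
        let _ , p , rs = anyRS-∈ any in ⧏⇒RS≤′ (rsG (inj₁ p)) accy y∈A (GL⧏y p) rs

      ⧏⇒RS≤′ : ∀ {G y r} → Acc _⊏_ G → Acc _⊏_ y → Elem A y → G ⧏ y → RS A G r → emb A r ≤ y
      ⧏⇒RS≤′ {⟨ _ ∣ _ ⟩} {r = r} _ _ y∈A G⧏y (inj₁ G≈r) =
        numeric-⧏⇒≤ (emb-numeric A r) (Elem-numeric y∈A) (≤-⧏-trans (proj₂ G≈r) G⧏y)
      ⧏⇒RS≤′ {⟨ _ ∣ _ ⟩} accG (acc rsy) y∈A (lf-l p G≤yL) rs@(inj₂ _) =
        ≤-trans (≤⇒RS≤′ accG (rsy (inj₁ p)) (Elem-left y∈A p) G≤yL rs) (proj₁ (Elem-numeric y∈A) p)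
      ⧏⇒RS≤′ {⟨ _ ∣ _ ⟩} (acc rsG) accy y∈A (lf-r p GR≤y) (inj₂ (_ , _ , all≥r)) =
        ≤-stable (¬¬-map (λ (s , ls) → ≤-trans (allLS≥-∈ all≥r p s ls)
                                                (≤⇒LS≤′ (rsG (inj₂ p)) accy y∈A GR≤y ls))
                         (LS-exists _))

      ≤⇒RS≤′ : ∀ {G y r} → Acc _⊏_ G → Acc _⊏_ y → Elem A y → G ≤ y → RS A G r → emb A r ≤ y
      ≤⇒RS≤′ {⟨ _ ∣ _ ⟩} _ _ _ G≤y (inj₁ G≈r) = ≤-trans (proj₂ G≈r) G≤y
      ≤⇒RS≤′ {⟨ _ ∣ _ ⟩} accG accy y∈A G≤y rs@(inj₂ (G∉A , _)) =
        ⧏⇒RS≤′ accG accy y∈A (≰⇒⧏ λ y≤G → G∉A (≈-Elem⇒InA y∈A (G≤y , y≤G))) rs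

  ⧏⇒≤LS : ∀ {G y l} → Elem A y → y ⧏ G → LS A G l → y ≤ emb A l
  ⧏⇒≤LS = ⧏⇒≤LS′ (⊏-wellFounded _) (⊏-wellFounded _)

  ≤⇒≤LS : ∀ {G y l} → Elem A y → y ≤ G → LS A G l → y ≤ emb A l
  ≤⇒≤LS = ≤⇒≤LS′ (⊏-wellFounded _) (⊏-wellFounded _)

  ⧏⇒RS≤ : ∀ {G y r} → Elem A y → G ⧏ y → RS A G r → emb A r ≤ y
  ⧏⇒RS≤ = ⧏⇒RS≤′ (⊏-wellFounded _) (⊏-wellFounded _)

  ≤⇒RS≤ : ∀ {G y r} → Elem A y → G ≤ y → RS A G r → emb A r ≤ y
  ≤⇒RS≤ = ≤⇒RS≤′ (⊏-wellFounded _) (⊏-wellFounded _)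

  module _ {G H : Game} {x : El A} (G≈H : G ≈ H) (H-right∈A : ∀ {HR} → HR ∈ right H → Elem A HR)
           (G∉A : ¬ InA A G) (x≤G : emb A x ≤ G) where

    private
      x⧏HR : ∀ {HR} → HR ∈ right H → emb A x ⧏ HR
      x⧏HR with ≤-trans x≤G (proj₁ G≈H)
      ... | le _ x⧏HR = x⧏HR

      mutual
        ≤⇒⧏RS′ : ∀ {K s} → Acc _⊏_ K → G ≤ K → RS A K s → emb A x ⧏ emb A s
        ≤⇒⧏RS′ {⟨ _ ∣ _ ⟩} {s} _ G≤K (inj₁ K≈s) with ≤⊎⧏ (emb A s) (emb A x)
        ... | inj₁ s≤x = ⊥-elim (G∉A (x , ≤-trans G≤K (≤-trans (proj₁ K≈s) s≤x) , x≤G))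
        ... | inj₂ x⧏s = x⧏s
        ≤⇒⧏RS′ {⟨ _ ∣ _ ⟩} (acc rsK) (le _ G⧏KR) (inj₂ (_ , any , _)) =
          let _ , p , ls = anyLS-∈ any in ⧏⇒⧏LS′ (rsK (inj₂ p)) (G⧏KR p) ls

        ⧏⇒⧏LS′ : ∀ {K l} → Acc _⊏_ K → G ⧏ K → LS A K l → emb A x ⧏ emb A l
        ⧏⇒⧏LS′ {⟨ _ ∣ _ ⟩} _ G⧏K (inj₁ K≈l) = ≤-⧏-trans x≤G (⧏-≤-trans G⧏K (proj₁ K≈l))
        ⧏⇒⧏LS′ {⟨ _ ∣ _ ⟩} (acc rsK) G⧏K ls@(inj₂ (_ , _ , all≤l)) with ≤-⧏-trans (proj₂ G≈H) G⧏K
        ... | lf-l p H≤KL = ⧏-stable (¬¬-map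
          (λ (s , rs) → ⧏-≤-trans (≤⇒⧏RS′ (rsK (inj₁ p)) (≤-trans (proj₁ G≈H) H≤KL) rs)
                                  (allRS≤-∈ all≤l p s rs))
          (RS-exists _))
        ... | lf-r p HR≤K = ⧏-≤-trans (x⧏HR p) (≤⇒≤LS (H-right∈A p) HR≤K ls)

    ≤⇒⧏RS : ∀ {r} → RS A G r → emb A x ⧏ emb A r
    ≤⇒⧏RS = ≤⇒⧏RS′ (⊏-wellFounded G) ≤-refl

  module _ {G H : Game} {x : El A} (G≈H : G ≈ H) (H-left∈A : ∀ {HL} → HL ∈ left H → Elem A HL)
           (G∉A : ¬ InA A G) (G≤x : G ≤ emb A x) where

    private
      HL⧏x : ∀ {HL} → HL ∈ left H → HL ⧏ emb A x
      HL⧏x with ≤-trans (proj₂ G≈H) G≤x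
      ... | le HL⧏x _ = HL⧏x

      mutual
        ≤⇒LS⧏′ : ∀ {K s} → Acc _⊏_ K → K ≤ G → LS A K s → emb A s ⧏ emb A x
        ≤⇒LS⧏′ {⟨ _ ∣ _ ⟩} {s} _ K≤G (inj₁ K≈s) with ≤⊎⧏ (emb A x) (emb A s)
        ... | inj₁ x≤s = ⊥-elim (G∉A (x , G≤x , ≤-trans x≤s (≤-trans (proj₂ K≈s) K≤G)))
        ... | inj₂ s⧏x = s⧏x
        ≤⇒LS⧏′ {⟨ _ ∣ _ ⟩} (acc rsK) (le KL⧏G _) (inj₂ (_ , any , _)) =
          let _ , p , rs = anyRS-∈ any in ⧏⇒RS⧏′ (rsK (inj₁ p)) (KL⧏G p) rs

        ⧏⇒RS⧏′ : ∀ {K r} → Acc _⊏_ K → K ⧏ G → RS A K r → emb A r ⧏ emb A x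
        ⧏⇒RS⧏′ {⟨ _ ∣ _ ⟩} _ K⧏G (inj₁ K≈r) = ⧏-≤-trans (≤-⧏-trans (proj₂ K≈r) K⧏G) G≤x
        ⧏⇒RS⧏′ {⟨ _ ∣ _ ⟩} (acc rsK) K⧏G rs@(inj₂ (_ , _ , all≥r)) with ⧏-≤-trans K⧏G (proj₁ G≈H)
        ... | lf-l p K≤HL = ≤-⧏-trans (≤⇒RS≤ (H-left∈A p) K≤HL rs) (HL⧏x p)
        ... | lf-r p KR≤H = ⧏-stable (¬¬-map
          (λ (s , ls) → ≤-⧏-trans (allLS≥-∈ all≥r p s ls)
                                  (≤⇒LS⧏′ (rsK (inj₂ p)) (≤-trans KR≤H (proj₂ G≈H)) ls))
          (LS-exists _))

    ≤⇒LS⧏ : ∀ {l} → LS A G l → emb A l ⧏ emb A x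
    ≤⇒LS⧏ = ≤⇒LS⧏′ (⊏-wellFounded G) ≤-refl

lemma1 : (A : NumSet) (G₀ G₁ : Game) →
    InBr A G₀ → InBr A G₁ → ¬ InA A G₁ →
    (x : El A) →
      (∀ r₀ r₁ → RS A G₀ r₀ → RS A G₁ r₁ → emb A r₁ ≤ emb A r₀ →
         ¬ (emb A x ≤ G₀) → ¬ (emb A x ≤ G₁))
    × (∀ l₀ l₁ → LS A G₀ l₀ → LS A G₁ l₁ → emb A l₀ ≤ emb A l₁ →
         ¬ (G₀ ≤ emb A x) → ¬ (G₁ ≤ emb A x))
lemma1 A G₀ G₁ _ (a , b , G₁≈⟨a∣b⟩) G₁∉A x =
  (λ r₀ r₁ rs₀ rs₁ r₁≤r₀ x≰G₀ x≤G₁ →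
     let x⧏r₁ = ≤⇒⧏RS G₁≈⟨a∣b⟩ (λ { (here refl) → b , refl }) G₁∉A x≤G₁ rs₁
         r₀≤x = ⧏⇒RS≤ (x , refl) (≰⇒⧏ x≰G₀) rs₀
     in ⧏-irrefl (⧏-≤-trans x⧏r₁ (≤-trans r₁≤r₀ r₀≤x))) ,
  (λ l₀ l₁ ls₀ ls₁ l₀≤l₁ G₀≰x G₁≤x →
     let l₁⧏x = ≤⇒LS⧏ G₁≈⟨a∣b⟩ (λ { (here refl) → a , refl }) G₁∉A G₁≤x ls₁
         x≤l₀ = ⧏⇒≤LS (x , refl) (≰⇒⧏ G₀≰x) ls₀
     in ⧏-irrefl (≤-⧏-trans (≤-trans x≤l₀ l₀≤l₁) l₁⧏x))
  where open Stops A
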